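{- Let $n\ge1$, let $\gamma\subseteq\delta$ be weak compositions with $n$ parts, and let $Y$ be a contre-lattice semistandard skyline filling of shape $\delta/\gamma$ with entries in $[n]$ on an arbitrary basement $(b_1,\dots,b_n)$ of positive integers, having at least one non-basement cell. Let $x$ be the smallest entry of $Y$ and let $x_1$ be the cell containing the first occurrence of $x$ in column reading order. Then the filling $Y'=Y-x_1$ obtained by deleting the cell $x_1$ (so that the row of $x_1$ becomes one cell shorter) is again a contre-lattice semistandard skyline filling.
   Context: Skyline diagrams. For a weak composition $\delta=(\delta_1,\dots,\delta_n)$ the skyline diagram of shape $\delta$ has rows $1,\dots,n$ numbered from top to bottom, row $i$ consisting of cells $(i,1),\dots,(i,\delta_i)$, together with a basement column $0$ whose cell $(i,0)$ contains a fixed positive integer $b_i$. If $\gamma\subseteq\delta$ componentwise, the skew diagram $\delta/\gamma$ additionally regards the cells $(i,k)$, $1\le k\le\gamma_i$, as basement cells containing $b_i$. A filling assigns positive integers to the non-basement cells. A type A triple is $(a,b,c)=((i,k),(j,k),(i,k-1))$ (cells of the diagram, basement allowed) with $i<j$, $k\ge1$, $\delta_i\ge\delta_j$; a type B triple is $(a,b,c)=((j,k+1),(i,k),(j,k))$ with $i<j$, $k\ge0$, $\delta_i<\delta_j$ (here $\delta$ is the overall shape of the filling under consideration). A triple is an inversion triple if its values satisfy $b<a\le c$ or $a\le c<b$, otherwise a coinversion triple. A semistandard skyline filling (SSK) is a filling whose rows (including basement cells) weakly decrease left to right and all of whose triples are inversion triples. Column reading order reads non-basement cells top to bottom in each column,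 columns taken from right to left; this gives the column word. A word with maximum letter $r$ is contre-lattice if in every initial segment, for each $1<j\le r$, there are at least as many $j$'s as $(j-1)$'s. A filling is contre-lattice if its column word is. -}

module Defs where

open import Data.Nat using (ℕ; zero; suc; _≤_; _<_; _≤ᵇ_; _<ᵇ_; _∸_; _⊔_; _≡ᵇ_)
open import Data.Nat.Properties using (_≤?_)
open import Data.Fin using (Fin; _≟_) renaming (_<_ to _<ᶠ_)
open import Data.Bool using (Bool; true; false; if_then_else_; _∧_)
open import Data.List using (List; []; _∷_; map; concatMap; filterᵇ; allFin; downFrom; foldr; take; length)
open import Data.Product using (_×_; _,_)
open import Data.Sum using (_⊎_)
open import Relation.Nullary using (does)

-- Conventions.
-- * Rows are indexed by Fin n (row i of the paper is Fin row i-1, top to bottom).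
-- * A shape / weak composition with n parts is a function Fin n → ℕ.
-- * A filling is a total function F : Fin n → ℕ → ℕ; only its values at the
--   non-basement cells (i,k), γ i < k ≤ δ i, are relevant.
-- * The value of a cell (i,k) (basement allowed, 0 ≤ k ≤ δ i) is b i when
--   k ≤ γ i (basement column 0 and skew basement cells), and F i k otherwise.

Shape : ℕ → Set
Shape n = Fin n → ℕ

Filling : ℕ → Set
Filling n = Fin n → ℕ → ℕ

Cell : ℕ → Set
Cell n = Fin n × ℕ

cellVal : ∀ {n} → (γ b : Shape n) → Filling n → Fin n → ℕ → ℕ
cellVal γ b F i k = if does (k ≤? γ i) then b i else F i k

EntriesIn : ∀ {n} → ℕ → (γ δ : Shape n) → Filling n → Set
EntriesIn {n} m γ δ F = ∀ (i : Fin n) (k : ℕ) → γ i < k → k ≤ δ i → (1 ≤ F i k) × (F i k ≤ m)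

InversionTriple : ℕ → ℕ → ℕ → Set
InversionTriple a b c = (b < a × a ≤ c) ⊎ (a ≤ c × c < b)

RowsWeaklyDecreasing : ∀ {n} → (γ δ b : Shape n) → Filling n → Set
RowsWeaklyDecreasing {n} γ δ b F =
  ∀ (i : Fin n) (k : ℕ) → suc k ≤ δ i → cellVal γ b F i (suc k) ≤ cellVal γ b F i k

-- type A triples ((i,k),(j,k),(i,k-1)), i<j, k≥1, δ_i ≥ δ_j, all three cells in
-- the diagram (i.e. k ≤ δ_j); written with k = suc k'.
TypeAInversions : ∀ {n} → (γ δ b : Shape n) → Filling n → Set
TypeAInversions {n} γ δ b F =
  ∀ (i j : Fin n) → i <ᶠ j → δ j ≤ δ i → ∀ (k : ℕ) → suc k ≤ δ j →
    InversionTriple (cellVal γ b F i (suc k)) (cellVal γ b F j (suc k)) (cellVal γ b F i k)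

-- type B triples ((j,k+1),(i,k),(j,k)), i<j, k≥0, δ_i < δ_j, all three cells in
-- the diagram (i.e. k ≤ δ_i).
TypeBInversions : ∀ {n} → (γ δ b : Shape n) → Filling n → Set
TypeBInversions {n} γ δ b F =
  ∀ (i j : Fin n) → i <ᶠ j → δ i < δ j → ∀ (k : ℕ) → k ≤ δ i →
    InversionTriple (cellVal γ b F j (suc k)) (cellVal γ b F i k) (cellVal γ b F j k)

SSK : ∀ {n} → (γ δ b : Shape n) → Filling n → Set
SSK γ δ b F = RowsWeaklyDecreasing γ δ b F × TypeAInversions γ δ b F × TypeBInversions γ δ b F

maxPart : ∀ {n} → Shape n → ℕ
maxPart {n} δ = foldr (λ i m → δ i ⊔ m) 0 (allFin n)

columnCells : ∀ {n} → (γ δ : Shape n) → List (Cell n)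
columnCells {n} γ δ =
  concatMap (λ c → map (λ i → (i , c))
                       (filterᵇ (λ i → (γ i <ᵇ c) ∧ (c ≤ᵇ δ i)) (allFin n)))
            (map suc (downFrom (maxPart δ)))

columnWord : ∀ {n} → (γ δ b : Shape n) → Filling n → List ℕ
columnWord γ δ b F = map (λ { (i , k) → cellVal γ b F i k }) (columnCells γ δ)

count : ℕ → List ℕ → ℕ
count a [] = 0
count a (x ∷ w) = if a ≡ᵇ x then suc (count a w) else count a w

maxLetter : List ℕ → ℕ
maxLetter = foldr _⊔_ 0

ContreLattice : List ℕ → Set
ContreLattice w = ∀ (m j : ℕ) → 2 ≤ j → j ≤ maxLetter w →
  count (j ∸ 1) (take m w) ≤ count j (take m w)

ContreLatticeFilling : ∀ {n} → (γ δ b : Shape n) → Filling n → Set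
ContreLatticeFilling γ δ b F = ContreLattice (columnWord γ δ b F)

-- deleting the cell (r,c): row r becomes one cell shorter, and the cells of
-- row r to the right of (r,c) (if any) move one step left.
deleteShape : ∀ {n} → Shape n → Cell n → Shape n
deleteShape δ (r , c) i = if does (i ≟ r) then δ i ∸ 1 else δ i

deleteFilling : ∀ {n} → Filling n → Cell n → Filling n
deleteFilling F (r , c) i k =
  if does (i ≟ r) ∧ does (c ≤? k) then F i (suc k) else F i k

valAt : ∀ {n} → (γ b : Shape n) → Filling n → Cell n → ℕ
valAt γ b F (i , k) = cellVal γ b F i k

-- The cell x₁ is the last cell of its row: a cell to its right lies in an
-- earlier column, so it is read before x₁, and since rows decrease it would
-- carry an entry ≤ x, hence = x. Deleting x₁ therefore just shortens its row,
-- and a triple of Y' that is not a triple of Y arises only where the order of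
-- the row lengths flips. For such a triple, failing to be an inversion triple
-- forces a strict inequality between the two rows that the old inversion
-- triples propagate rightwards up to x₁, producing an entry smaller than x.
-- Finally the column word of Y' is that of Y with one occurrence of its
-- smallest letter removed, and that preserves the contre-lattice property.
module Submission where

open import Defs
open import Data.Nat using (ℕ; zero; suc; _≟_; >-nonZero; _≤_; _<_; _∸_; _⊔_; _≡ᵇ_; _<ᵇ_; _≤ᵇ_; z≤n; s≤s; _≤′_; ≤′-refl; ≤′-step)
open import Data.Nat.Properties hiding (_≟_)
open import Data.Fin using (Fin) renaming (_≟_ to _≟ᶠ_; _<_ to _<ᶠ_)
open import Data.Fin.Properties using () renaming (<⇒≢ to <ᶠ⇒≢)
open import Data.Bool using (Bool; true; false; T; _∧_; if_then_else_)
open import Data.Bool.Properties using (T-∧; T?)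
open import Data.List using (List; []; _∷_; _++_; map; take; filterᵇ; allFin; foldr; concatMap; downFrom)
open import Data.List.Properties using (∷-injective; filter-none)
open import Data.List.Membership.Propositional using (_∈_)
open import Data.List.Membership.Propositional.Properties using (∈-allFin; ∈-map⁺; ∈-++⁺ˡ; ∈-++⁺ʳ; ∈-++⁻; ∈-filter⁺)
open import Data.List.Relation.Unary.Any using (here; there)
open import Data.List.Relation.Unary.All as All using (All; []; _∷_)
import Data.List.Relation.Unary.All.Properties as AllP
open import Data.Product using (_×_; _,_; ∃-syntax; proj₁; proj₂)
open import Data.Sum using (_⊎_; inj₁; inj₂)
open import Data.Empty using (⊥-elim)
open import Function using (_∘_)
open import Function.Bundles using (Equivalence)
open import Relation.Nullary using (¬_; yes; no; does)
open import Relation.Binary.PropositionalEquality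

-- Words

count-≢ : ∀ {a x} w → a ≢ x → count a (x ∷ w) ≡ count a w
count-≢ {a} {x} w a≢x with a ≡ᵇ x | ≡ᵇ⇒≡ a x
... | true  | a≡x = ⊥-elim (a≢x (a≡x _))
... | false | _   = refl

count-self : ∀ x w → count x (x ∷ w) ≡ suc (count x w)
count-self x w with x ≡ᵇ x | ≡⇒≡ᵇ x x refl
... | true | _ = refl

count-below-min : ∀ {x y} w → All (x ≤_) w → y < x → count y w ≡ 0
count-below-min [] [] y<x = refl
count-below-min (a ∷ w) (x≤a ∷ x≤w) y<x =
  trans (count-≢ w (λ { refl → <⇒≱ y<x x≤a })) (count-below-min w x≤w y<x)

data Inserts {A : Set} (z : A) : List A → List A → Set where
  []     : Inserts z [] []
  keep   : ∀ {xs ys} a → Inserts z xs ys → Inserts z (a ∷ xs) (a ∷ ys)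
  insert : ∀ {xs ys} → Inserts z xs ys → Inserts z xs (z ∷ ys)

module _ {A : Set} {z : A} where

  Inserts-++ : ∀ {xs ys us vs} → Inserts z xs ys → Inserts z us vs → Inserts z (xs ++ us) (ys ++ vs)
  Inserts-++ []         e = e
  Inserts-++ (keep a d) e = keep a (Inserts-++ d e)
  Inserts-++ (insert d) e = insert (Inserts-++ d e)

  Inserts-All : ∀ {P : A → Set} {xs ys} → Inserts z xs ys → All P ys → All P xs
  Inserts-All []         []       = []
  Inserts-All (keep a d) (p ∷ ps) = p ∷ Inserts-All d ps
  Inserts-All (insert d) (_ ∷ ps) = Inserts-All d ps

  Inserts-map : ∀ {B : Set} (f g : A → B) {xs ys} → Inserts z xs ys →
    All (λ a → g a ≡ f a) xs → Inserts (f z) (map g xs) (map f ys)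
  Inserts-map f g []         []         = []
  Inserts-map f g (keep a d) (ga≡fa ∷ e) rewrite ga≡fa = keep (f a) (Inserts-map f g d e)
  Inserts-map f g (insert d) e = insert (Inserts-map f g d e)

  Inserts-take : ∀ {xs ys} → Inserts z xs ys → ∀ m → ∃[ m' ] Inserts z (take m xs) (take m' ys)
  Inserts-take d          zero    = 0 , []
  Inserts-take []         (suc m) = 0 , []
  Inserts-take (keep a d) (suc m) = let m' , dₘ = Inserts-take d m in suc m' , keep a dₘ
  Inserts-take (insert d) (suc m) = let m' , dₘ = Inserts-take d (suc m) in suc m' , insert dₘ

  filterᵇ-Inserts : ∀ {B : Set} (f : B → A) (p q : B → Bool) xs →
    (∀ a → T (q a) → T (p a)) → (∀ a → T (p a) → ¬ T (q a) → f a ≡ z) →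
    Inserts z (map f (filterᵇ q xs)) (map f (filterᵇ p xs))
  filterᵇ-Inserts f p q [] q⇒p p∖q⇒z = []
  filterᵇ-Inserts f p q (a ∷ xs) q⇒p p∖q⇒z with p a | q a | q⇒p a | p∖q⇒z a
  ... | true  | true  | _   | _   = keep (f a) (filterᵇ-Inserts f p q xs q⇒p p∖q⇒z)
  ... | true  | false | _   | fa≡z rewrite fa≡z _ (λ ()) = insert (filterᵇ-Inserts f p q xs q⇒p p∖q⇒z)
  ... | false | true  | q⇒p | _   = ⊥-elim (q⇒p _)
  ... | false | false | _   | _   = filterᵇ-Inserts f p q xs q⇒p p∖q⇒z

module _ {z : ℕ} where

  count-Inserts-≢ : ∀ {a xs ys} → a ≢ z → Inserts z xs ys → count a xs ≡ count a ys
  count-Inserts-≢ a≢z [] = refl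
  count-Inserts-≢ {a} a≢z (keep b d) with a ≡ᵇ b
  ... | true  = cong suc (count-Inserts-≢ a≢z d)
  ... | false = count-Inserts-≢ a≢z d
  count-Inserts-≢ a≢z (insert {ys = ys} d) = trans (count-Inserts-≢ a≢z d) (sym (count-≢ ys a≢z))

  count-Inserts-≤ : ∀ {xs ys} → Inserts z xs ys → count z xs ≤ count z ys
  count-Inserts-≤ [] = z≤n
  count-Inserts-≤ (keep a d) with z ≡ᵇ a
  ... | true  = s≤s (count-Inserts-≤ d)
  ... | false = count-Inserts-≤ d
  count-Inserts-≤ (insert {ys = ys} d) rewrite count-self z ys = m≤n⇒m≤1+n (count-Inserts-≤ d)

  maxLetter-Inserts : ∀ {xs ys} → Inserts z xs ys → maxLetter xs ≤ maxLetter ys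
  maxLetter-Inserts []         = z≤n
  maxLetter-Inserts (keep a d) = ⊔-monoʳ-≤ a (maxLetter-Inserts d)
  maxLetter-Inserts (insert d) = ≤-trans (maxLetter-Inserts d) (m≤n⊔m z _)

ContreLattice-Inserts-min : ∀ {x xs ys} → Inserts x xs ys → All (x ≤_) ys →
  ContreLattice ys → ContreLattice xs
ContreLattice-Inserts-min {x} {xs} d x≤ys cl m j 2≤j j≤max
  with Inserts-take d m | j ≟ x | j ∸ 1 ≟ x
... | m' , dₘ | yes refl | _ =
  ≤-trans (≤-reflexive (count-below-min (take m xs) (AllP.take⁺ m (Inserts-All d x≤ys)) (pred< 2≤j))) z≤n
  where
  pred< : ∀ {j} → 2 ≤ j → j ∸ 1 < j
  pred< (s≤s _) = ≤-refl
... | m' , dₘ | no j≢x | yes refl =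
  ≤-trans (count-Inserts-≤ dₘ) (≤-trans (cl m' j 2≤j (≤-trans j≤max (maxLetter-Inserts d)))
                                         (≤-reflexive (sym (count-Inserts-≢ j≢x dₘ))))
... | m' , dₘ | no j≢x | no j-1≢x =
  subst₂ _≤_ (sym (count-Inserts-≢ j-1≢x dₘ)) (sym (count-Inserts-≢ j≢x dₘ))
         (cl m' j 2≤j (≤-trans j≤max (maxLetter-Inserts d)))

split-++-∷ : ∀ {A : Set} (xs ys pre post : List A) {z} → xs ++ ys ≡ pre ++ (z ∷ post) →
  (∃[ pre' ] pre ≡ xs ++ pre' × ys ≡ pre' ++ (z ∷ post)) ⊎ z ∈ xs
split-++-∷ []       ys pre        post e = inj₁ (pre , refl , e)
split-++-∷ (x ∷ xs) ys []         post e with ∷-injective e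
... | refl , _ = inj₂ (here refl)
split-++-∷ (x ∷ xs) ys (p ∷ pre)  post e with ∷-injective e
... | refl , e' with split-++-∷ xs ys pre post e'
... | inj₁ (pre' , refl , ys≡) = inj₁ (pre' , refl , ys≡)
... | inj₂ z∈xs = inj₂ (there z∈xs)

-- Column reading order

maxPart-upper : ∀ {n} (δ : Shape n) i → δ i ≤ maxPart δ
maxPart-upper {n} δ i = go (allFin n) (∈-allFin i)
  where
  go : ∀ is → i ∈ is → δ i ≤ foldr (λ i m → δ i ⊔ m) 0 is
  go (a ∷ is) (here refl) = m≤m⊔n (δ i) _
  go (a ∷ is) (there i∈is) = ≤-trans (go is i∈is) (m≤n⊔m (δ a) _)

maxPart-least : ∀ {n} (δ : Shape n) K → (∀ i → δ i ≤ K) → maxPart δ ≤ K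
maxPart-least {n} δ K δ≤K = go (allFin n)
  where
  go : ∀ is → foldr (λ i m → δ i ⊔ m) 0 is ≤ K
  go []       = z≤n
  go (a ∷ is) = ⊔-lub (δ≤K a) (go is)

module ColumnReading {n : ℕ} (γ : Shape n) where

  InDiagram : Shape n → Cell n → Set
  InDiagram δ (i , k) = γ i < k × k ≤ δ i

  inColumn : Shape n → ℕ → Fin n → Bool
  inColumn δ c i = (γ i <ᵇ c) ∧ (c ≤ᵇ δ i)

  inColumn⇒InDiagram : ∀ δ c i → T (inColumn δ c i) → InDiagram δ (i , c)
  inColumn⇒InDiagram δ c i t =
    let t₁ , t₂ = Equivalence.to T-∧ t in <ᵇ⇒< (γ i) c t₁ , ≤ᵇ⇒≤ c (δ i) t₂

  InDiagram⇒inColumn : ∀ δ c i → InDiagram δ (i , c) → T (inColumn δ c i)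
  InDiagram⇒inColumn δ c i (γi<c , c≤δi) = Equivalence.from T-∧ (<⇒<ᵇ γi<c , ≤⇒≤ᵇ c≤δi)

  column : Shape n → ℕ → List (Cell n)
  column δ c = map (λ i → (i , c)) (filterᵇ (inColumn δ c) (allFin n))

  columnsUpTo : ℕ → Shape n → List (Cell n)
  columnsUpTo M δ = concatMap (column δ) (map suc (downFrom M))

  column-InDiagram : ∀ δ c → All (InDiagram δ) (column δ c)
  column-InDiagram δ c = AllP.map⁺ (All.map (inColumn⇒InDiagram δ c _)
                                            (AllP.all-filter (T? ∘ inColumn δ c) (allFin n)))

  column-index : ∀ δ c → All (λ p → proj₂ p ≡ c) (column δ c)
  column-index δ c = AllP.map⁺ (All.universal (λ _ → refl) (filterᵇ (inColumn δ c) (allFin n)))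

  columnsUpTo-InDiagram : ∀ M δ → All (InDiagram δ) (columnsUpTo M δ)
  columnsUpTo-InDiagram zero    δ = []
  columnsUpTo-InDiagram (suc M) δ = AllP.++⁺ (column-InDiagram δ (suc M)) (columnsUpTo-InDiagram M δ)

  columnsUpTo-column≤ : ∀ M δ → All (λ p → proj₂ p ≤ M) (columnsUpTo M δ)
  columnsUpTo-column≤ zero    δ = []
  columnsUpTo-column≤ (suc M) δ =
    AllP.++⁺ (All.map ≤-reflexive (column-index δ (suc M))) (All.map m≤n⇒m≤1+n (columnsUpTo-column≤ M δ))

  ∈-columnsUpTo : ∀ M δ {i k} → InDiagram δ (i , k) → k ≤ M → (i , k) ∈ columnsUpTo M δ
  ∈-columnsUpTo zero    δ (γi<k , _) k≤0 = ⊥-elim (<⇒≱ (<-≤-trans γi<k k≤0) z≤n)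
  ∈-columnsUpTo (suc M) δ {i} {k} ik k≤M with m≤n⇒m<n∨m≡n k≤M
  ... | inj₁ k<M  = ∈-++⁺ʳ (column δ (suc M)) (∈-columnsUpTo M δ ik (≤-pred k<M))
  ... | inj₂ refl = ∈-++⁺ˡ (∈-map⁺ (λ i → (i , suc M))
                      (∈-filter⁺ (T? ∘ inColumn δ k) (∈-allFin i) (InDiagram⇒inColumn δ k i ik)))

  columnsUpTo-stable : ∀ δ {N M} → (∀ i → δ i ≤ N) → N ≤′ M → columnsUpTo M δ ≡ columnsUpTo N δ
  columnsUpTo-stable δ δ≤N ≤′-refl = refl
  columnsUpTo-stable δ {N} {suc M} δ≤N (≤′-step N≤′M) =
    trans (cong (_++ columnsUpTo M δ) empty) (columnsUpTo-stable δ δ≤N N≤′M)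
    where
    empty : column δ (suc M) ≡ []
    empty = cong (map _) (filter-none (T? ∘ inColumn δ (suc M)) (All.universal
      (λ i t → <⇒≱ (s≤s (≤-trans (δ≤N i) (≤′⇒≤ N≤′M))) (proj₂ (inColumn⇒InDiagram δ (suc M) i t))) (allFin n)))

  later-column-read-before : ∀ M δ pre post z y → columnsUpTo M δ ≡ pre ++ (z ∷ post) →
    y ∈ columnsUpTo M δ → proj₂ z < proj₂ y → y ∈ pre
  later-column-read-before (suc M) δ pre post z y e y∈ z<y
    with split-++-∷ (column δ (suc M)) (columnsUpTo M δ) pre post e
  ... | inj₂ z∈col = ⊥-elim (<⇒≱ z<y (subst (proj₂ y ≤_)
          (sym (All.lookup (column-index δ (suc M)) z∈col))
          (All.lookup (columnsUpTo-column≤ (suc M) δ) y∈)))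
  ... | inj₁ (pre' , refl , rest≡) with ∈-++⁻ (column δ (suc M)) y∈
  ... | inj₁ y∈col  = ∈-++⁺ˡ y∈col
  ... | inj₂ y∈rest = ∈-++⁺ʳ (column δ (suc M)) (later-column-read-before M δ pre' post z y rest≡ y∈rest z<y)

  columnsUpTo-Inserts : ∀ z M δ δ' → (∀ p → InDiagram δ' p → InDiagram δ p) →
    (∀ p → InDiagram δ p → ¬ InDiagram δ' p → p ≡ z) → Inserts z (columnsUpTo M δ') (columnsUpTo M δ)
  columnsUpTo-Inserts z zero    δ δ' δ'⊆δ δ∖δ'≡z = []
  columnsUpTo-Inserts z (suc M) δ δ' δ'⊆δ δ∖δ'≡z = Inserts-++
    (filterᵇ-Inserts _ (inColumn δ (suc M)) (inColumn δ' (suc M)) (allFin n)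
      (λ i t → InDiagram⇒inColumn δ (suc M) i (δ'⊆δ _ (inColumn⇒InDiagram δ' (suc M) i t)))
      (λ i t ¬t → δ∖δ'≡z _ (inColumn⇒InDiagram δ (suc M) i t) (¬t ∘ InDiagram⇒inColumn δ' (suc M) i)))
    (columnsUpTo-Inserts z M δ δ' δ'⊆δ δ∖δ'≡z)

-- Inversion triples along two rows

inversion-b≤c⇒b<a : ∀ {a b c} → b ≤ c → InversionTriple a b c → b < a
inversion-b≤c⇒b<a _   (inj₁ (b<a , _)) = b<a
inversion-b≤c⇒b<a b≤c (inj₂ (_ , c<b)) = ⊥-elim (<⇒≱ c<b b≤c)

<-propagates : (s t : ℕ → ℕ) {lo hi : ℕ} → lo ≤′ hi →
  (∀ m → suc m ≤ hi → s (suc m) ≤ s m) →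
  (∀ m → suc m ≤ hi → InversionTriple (t (suc m)) (s (suc m)) (t m)) →
  s lo < t lo → s hi < t hi
<-propagates s t ≤′-refl _ _ s<t = s<t
<-propagates s t {hi = suc hi} (≤′-step lo≤′hi) s↘ inv s<t =
  inversion-b≤c⇒b<a (≤-trans (s↘ hi ≤-refl) (<⇒≤ IH)) (inv hi ≤-refl)
  where
  IH : s hi < t hi
  IH = <-propagates s t lo≤′hi (λ m → s↘ m ∘ m≤n⇒m≤1+n) (λ m → inv m ∘ m≤n⇒m≤1+n) s<t

-- Rows u of length D above v of length D + 1, where v loses its last cell:
-- the new type A triples are inversion triples provided a descent of u
-- (which only happens among non-basement cells) forces u D ≥ v (D + 1).
typeA-from-typeB : (u v : ℕ → ℕ) (D k : ℕ) → suc k ≤ D →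
  (∀ m → suc m ≤ D → u (suc m) ≤ u m) →
  (∀ m → suc m ≤ suc D → v (suc m) ≤ v m) →
  (∀ m → m ≤ D → InversionTriple (v (suc m)) (u m) (v m)) →
  (u (suc k) < u k → v (suc D) ≤ u D) →
  InversionTriple (u (suc k)) (v (suc k)) (u k)
typeA-from-typeB u v D k k<D u↘ v↘ typeB descent with v (suc k) <? u (suc k) | u k <? v (suc k)
... | yes v<u  | _       = inj₁ (v<u , u↘ k k<D)
... | no _     | yes u<v = inj₂ (u↘ k k<D , u<v)
... | no v≮u   | no u≮v  = ⊥-elim (<⇒≱ uD<vD+1 (descent u-descends))
  where
  u≤v : u (suc k) ≤ v (suc k)
  u≤v = ≮⇒≥ v≮u
  vk<uk : v k < u k
  vk<uk with typeB k (≤-trans (n≤1+n k) k<D)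
  ... | inj₁ (u<v , _)  = ⊥-elim (u≮v u<v)
  ... | inj₂ (_ , v<u) = v<u
  u-descends : u (suc k) < u k
  u-descends = ≤-<-trans u≤v (≤-<-trans (v↘ k (s≤s (≤-trans (n≤1+n k) k<D))) vk<uk)
  uD<vD+1 : u D < v (suc D)
  uD<vD+1 = <-propagates u (v ∘ suc) (≤⇒≤′ k<D) u↘ (λ m → typeB (suc m))
              (inversion-b≤c⇒b<a u≤v (typeB (suc k) k<D))

-- Rows v above w, both of length C, where v loses its last cell: the new
-- type B triples are inversion triples under the analogous proviso.
typeB-from-typeA : (w v : ℕ → ℕ) (C k : ℕ) → suc k ≤ C →
  (∀ m → suc m ≤ C → w (suc m) ≤ w m) →
  (∀ m → suc m ≤ C → v (suc m) ≤ v m) →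
  (∀ m → suc m ≤ C → InversionTriple (v (suc m)) (w (suc m)) (v m)) →
  (w (suc k) < w k → v C ≤ w C) →
  InversionTriple (w (suc k)) (v k) (w k)
typeB-from-typeA w v C k k<C w↘ v↘ typeA descent with v k <? w (suc k) | w k <? v k
... | yes v<w | _       = inj₁ (v<w , w↘ k k<C)
... | no _    | yes w<v = inj₂ (w↘ k k<C , w<v)
... | no v≮w  | no w≮v  = ⊥-elim (<⇒≱ wC<vC (descent w-descends))
  where
  w<v : w (suc k) < v (suc k)
  w<v = inversion-b≤c⇒b<a (≮⇒≥ v≮w) (typeA k k<C)
  w-descends : w (suc k) < w k
  w-descends = <-≤-trans w<v (≤-trans (v↘ k k<C) (≮⇒≥ w≮v))
  wC<vC : w C < v C
  wC<vC = <-propagates w v (≤⇒≤′ k<C) w↘ typeA w<v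

module _ {n : ℕ} (γ b : Shape n) where

  cellVal-basement : ∀ (F : Filling n) i {k} → k ≤ γ i → cellVal γ b F i k ≡ b i
  cellVal-basement F i {k} k≤γi with k ≤ᵇ γ i | ≤⇒≤ᵇ k≤γi
  ... | true | _ = refl

  cellVal-cong : ∀ (F G : Filling n) i k → F i k ≡ G i k → cellVal γ b F i k ≡ cellVal γ b G i k
  cellVal-cong F G i k = cong (if does (k ≤? γ i) then b i else_)

  descent⇒non-basement : ∀ (F : Filling n) i k → cellVal γ b F i (suc k) < cellVal γ b F i k → γ i < suc k
  descent⇒non-basement F i k desc = ≰⇒> λ k<γi →
    <-irrefl (trans (cellVal-basement F i k<γi) (sym (cellVal-basement F i (≤-trans (n≤1+n k) k<γi)))) desc

module _ {n : ℕ} (δ : Shape n) (r : Fin n) (c : ℕ) where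

  deleteShape-self : deleteShape δ (r , c) r ≡ δ r ∸ 1
  deleteShape-self with r ≟ᶠ r
  ... | yes _   = refl
  ... | no r≢r = ⊥-elim (r≢r refl)

  deleteShape-other : ∀ {i} → i ≢ r → deleteShape δ (r , c) i ≡ δ i
  deleteShape-other {i} i≢r with i ≟ᶠ r
  ... | yes i≡r = ⊥-elim (i≢r i≡r)
  ... | no _    = refl

  deleteShape-≤ : ∀ i → deleteShape δ (r , c) i ≤ δ i
  deleteShape-≤ i with i ≟ᶠ r
  ... | yes _ = m∸n≤m (δ i) 1
  ... | no _  = ≤-refl

deleteFilling-left : ∀ {n} (F : Filling n) r c i k → (i ≡ r → k < c) → deleteFilling F (r , c) i k ≡ F i k
deleteFilling-left F r c i k k<c with i ≟ᶠ r
... | no _ = refl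
... | yes i≡r with c ≤ᵇ k | ≤ᵇ⇒≤ c k
... | false | _   = refl
... | true  | c≤k = ⊥-elim (<⇒≱ (k<c i≡r) (c≤k _))

-- Deleting the first occurrence of the smallest entry

module DeleteFirstMinimum {n : ℕ} (γ δ b : Shape n) (F : Filling n)
  (ssk : SSK γ δ b F) (cl : ContreLatticeFilling γ δ b F)
  (x : ℕ) (r : Fin n) (c : ℕ) (pre post : List (Cell n))
  (cells≡ : columnCells γ δ ≡ pre ++ ((r , c) ∷ post)) (val-rc : cellVal γ b F r c ≡ x)
  (x-min : All (λ p → x ≤ valAt γ b F p) (columnCells γ δ))
  (x-first : All (λ p → valAt γ b F p ≢ x) pre) where

  open ColumnReading γ

  val : Fin n → ℕ → ℕ
  val = cellVal γ b F

  δ' : Shape n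
  δ' = deleteShape δ (r , c)

  F' : Filling n
  F' = deleteFilling F (r , c)

  val' : Fin n → ℕ → ℕ
  val' = cellVal γ b F'

  rows : RowsWeaklyDecreasing γ δ b F
  rows = proj₁ ssk

  typeA : TypeAInversions γ δ b F
  typeA = proj₁ (proj₂ ssk)

  typeB : TypeBInversions γ δ b F
  typeB = proj₂ (proj₂ ssk)

  rc-InDiagram : InDiagram δ (r , c)
  rc-InDiagram = All.lookup (columnsUpTo-InDiagram (maxPart δ) δ)
                            (subst ((r , c) ∈_) (sym cells≡) (∈-++⁺ʳ pre (here refl)))

  ∈-columnCells : ∀ {i k} → InDiagram δ (i , k) → (i , k) ∈ columnCells γ δ
  ∈-columnCells {i} ik = ∈-columnsUpTo (maxPart δ) δ ik (≤-trans (proj₂ ik) (maxPart-upper δ i))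

  x≤val : ∀ {i k} → InDiagram δ (i , k) → x ≤ val i k
  x≤val ik = All.lookup x-min (∈-columnCells ik)

  x≤val-after-descent : ∀ i k m → val i (suc k) < val i k → suc k ≤ m → m ≤ δ i → x ≤ val i m
  x≤val-after-descent i k m desc k<m m≤δi =
    x≤val (<-≤-trans (descent⇒non-basement γ b F i k desc) k<m , m≤δi)

  c≡δr : c ≡ δ r
  c≡δr with c <? δ r
  ... | no c≮δr  = ≤-antisym (proj₂ rc-InDiagram) (≮⇒≥ c≮δr)
  ... | yes c<δr = ⊥-elim (All.lookup x-first right-read-before right≡x)
    where
    right : InDiagram δ (r , suc c)
    right = m<n⇒m<1+n (proj₁ rc-InDiagram) , c<δr
    right-read-before : (r , suc c) ∈ pre
    right-read-before = later-column-read-before (maxPart δ) δ pre post (r , c) (r , suc c)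
                          cells≡ (∈-columnCells right) ≤-refl
    right≡x : val r (suc c) ≡ x
    right≡x = ≤-antisym (subst (val r (suc c) ≤_) val-rc (rows r c c<δr)) (x≤val right)

  val-end-of-r : val r (δ r) ≡ x
  val-end-of-r = subst (λ k → val r k ≡ x) c≡δr val-rc

  suc-δ'r : suc (δ' r) ≡ δ r
  suc-δ'r = trans (cong suc (deleteShape-self δ r c))
                  (suc-pred (δ r) {{>-nonZero (≤-trans (s≤s z≤n) (<-≤-trans (proj₁ rc-InDiagram) (proj₂ rc-InDiagram)))}})

  δ'≤δ : ∀ i → δ' i ≤ δ i
  δ'≤δ = deleteShape-≤ δ r c

  val'≡val : ∀ i k → k ≤ δ' i → val' i k ≡ val i k
  val'≡val i k k≤δ'i = cellVal-cong γ b F' F i k (deleteFilling-left F r c i k k<c)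
    where
    k<c : i ≡ r → k < c
    k<c refl = subst (suc k ≤_) (trans suc-δ'r (sym c≡δr)) (s≤s k≤δ'i)

  row-r-or-unchanged : ∀ i → i ≡ r ⊎ δ' i ≡ δ i
  row-r-or-unchanged i with i ≟ᶠ r
  ... | yes i≡r = inj₁ i≡r
  ... | no _    = inj₂ refl

  flip⇒row-r-longer : ∀ i j → δ' j ≤ δ' i → δ i < δ j → j ≡ r
  flip⇒row-r-longer i j δ'j≤δ'i δi<δj with row-r-or-unchanged j
  ... | inj₁ j≡r    = j≡r
  ... | inj₂ δ'j≡δj = ⊥-elim (<⇒≱ δi<δj (subst (_≤ δ i) δ'j≡δj (≤-trans δ'j≤δ'i (δ'≤δ i))))

  flip⇒row-r-shorter : ∀ i j → δ' i < δ' j → δ j ≤ δ i → i ≡ r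
  flip⇒row-r-shorter i j δ'i<δ'j δj≤δi with row-r-or-unchanged i
  ... | inj₁ i≡r    = i≡r
  ... | inj₂ δ'i≡δi = ⊥-elim (<⇒≱ (subst (_< δ' j) δ'i≡δi δ'i<δ'j) (≤-trans (δ'≤δ j) δj≤δi))

  rows' : RowsWeaklyDecreasing γ δ' b F'
  rows' i k k<δ'i rewrite val'≡val i (suc k) k<δ'i | val'≡val i k (≤-trans (n≤1+n k) k<δ'i) =
    rows i k (≤-trans k<δ'i (δ'≤δ i))

  new-typeA : ∀ i → i <ᶠ r → δ' r ≤ δ' i → δ i < δ r → ∀ k → suc k ≤ δ' r →
    InversionTriple (val i (suc k)) (val r (suc k)) (val i k)
  new-typeA i i<r δ'r≤δ'i δi<δr k k<δ'r =
    typeA-from-typeB (val i) (val r) (δ i) k k<δi (rows i)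
      (λ m m<δi+1 → rows r m (subst (suc m ≤_) δi+1≡δr m<δi+1)) (typeB i r i<r δi<δr) descent
    where
    δ'i≡δi : δ' i ≡ δ i
    δ'i≡δi = deleteShape-other δ r c (<ᶠ⇒≢ i<r)
    δi+1≡δr : suc (δ i) ≡ δ r
    δi+1≡δr = ≤-antisym δi<δr (subst₂ _≤_ suc-δ'r (cong suc δ'i≡δi) (s≤s δ'r≤δ'i))
    k<δi : suc k ≤ δ i
    k<δi = ≤-trans k<δ'r (subst (δ' r ≤_) δ'i≡δi δ'r≤δ'i)
    descent : val i (suc k) < val i k → val r (suc (δ i)) ≤ val i (δ i)
    descent desc = subst (_≤ val i (δ i)) (sym (trans (cong (val r) δi+1≡δr) val-end-of-r))
                         (x≤val-after-descent i k (δ i) desc k<δi ≤-refl)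

  typeA' : TypeAInversions γ δ' b F'
  typeA' i j i<j δ'j≤δ'i k k<δ'j
    rewrite val'≡val i (suc k) (≤-trans k<δ'j δ'j≤δ'i) | val'≡val j (suc k) k<δ'j
          | val'≡val i k (≤-trans (n≤1+n k) (≤-trans k<δ'j δ'j≤δ'i))
    with δ j ≤? δ i
  ... | yes δj≤δi = typeA i j i<j δj≤δi k (≤-trans k<δ'j (δ'≤δ j))
  ... | no δj≰δi with flip⇒row-r-longer i j δ'j≤δ'i (≰⇒> δj≰δi)
  ... | refl = new-typeA i i<j δ'j≤δ'i (≰⇒> δj≰δi) k k<δ'j

  new-typeB : ∀ j → r <ᶠ j → δ' r < δ' j → δ j ≤ δ r → ∀ k → k ≤ δ' r →
    InversionTriple (val j (suc k)) (val r k) (val j k)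
  new-typeB j r<j δ'r<δ'j δj≤δr k k≤δ'r =
    typeB-from-typeA (val j) (val r) (δ r) k k<δr
      (λ m m<δr → rows j m (subst (suc m ≤_) (sym δj≡δr) m<δr)) (rows r)
      (λ m m<δr → typeA r j r<j δj≤δr m (subst (suc m ≤_) (sym δj≡δr) m<δr)) descent
    where
    δ'j≡δj : δ' j ≡ δ j
    δ'j≡δj = deleteShape-other δ r c (≢-sym (<ᶠ⇒≢ r<j))
    δj≡δr : δ j ≡ δ r
    δj≡δr = ≤-antisym δj≤δr (subst₂ _≤_ suc-δ'r δ'j≡δj δ'r<δ'j)
    k<δr : suc k ≤ δ r
    k<δr = subst (suc k ≤_) suc-δ'r (s≤s k≤δ'r)
    descent : val j (suc k) < val j k → val r (δ r) ≤ val j (δ r)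
    descent desc = subst (_≤ val j (δ r)) (sym val-end-of-r)
                         (x≤val-after-descent j k (δ r) desc k<δr (≤-reflexive (sym δj≡δr)))

  typeB' : TypeBInversions γ δ' b F'
  typeB' i j i<j δ'i<δ'j k k≤δ'i
    rewrite val'≡val j (suc k) (≤-trans (s≤s k≤δ'i) δ'i<δ'j) | val'≡val i k k≤δ'i
          | val'≡val j k (≤-trans k≤δ'i (<⇒≤ δ'i<δ'j))
    with δ i <? δ j
  ... | yes δi<δj = typeB i j i<j δi<δj k (≤-trans k≤δ'i (δ'≤δ i))
  ... | no δi≮δj with flip⇒row-r-shorter i j δ'i<δ'j (≮⇒≥ δi≮δj)
  ... | refl = new-typeB j i<j δ'i<δ'j (≮⇒≥ δi≮δj) k k≤δ'i

  SSK-deleted : SSK γ δ' b F'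
  SSK-deleted = rows' , typeA' , typeB'

  δ'⊆δ : ∀ p → InDiagram δ' p → InDiagram δ p
  δ'⊆δ (i , k) (γi<k , k≤δ'i) = γi<k , ≤-trans k≤δ'i (δ'≤δ i)

  δ∖δ'≡rc : ∀ p → InDiagram δ p → ¬ InDiagram δ' p → p ≡ (r , c)
  δ∖δ'≡rc (i , k) (γi<k , k≤δi) ∉δ' with row-r-or-unchanged i
  ... | inj₂ δ'i≡δi = ⊥-elim (∉δ' (γi<k , subst (k ≤_) (sym δ'i≡δi) k≤δi))
  ... | inj₁ refl = cong (r ,_) (≤-antisym (subst (k ≤_) (sym c≡δr) k≤δi) c≤k)
    where
    c≤k : c ≤ k
    c≤k = subst (_≤ k) (trans suc-δ'r (sym c≡δr)) (≰⇒> (λ k≤δ'r → ∉δ' (γi<k , k≤δ'r)))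

  cells-Inserts : Inserts (r , c) (columnCells γ δ') (columnCells γ δ)
  cells-Inserts = subst (λ cells → Inserts (r , c) cells (columnCells γ δ))
    (columnsUpTo-stable δ' (maxPart-upper δ')
      (≤⇒≤′ (maxPart-least δ' (maxPart δ) (λ i → ≤-trans (δ'≤δ i) (maxPart-upper δ i)))))
    (columnsUpTo-Inserts (r , c) (maxPart δ) δ δ' δ'⊆δ δ∖δ'≡rc)

  word-Inserts : Inserts x (columnWord γ δ' b F') (columnWord γ δ b F)
  word-Inserts = subst (λ y → Inserts y (columnWord γ δ' b F') (columnWord γ δ b F)) val-rc
    (Inserts-map (valAt γ b F) (valAt γ b F') cells-Inserts
      (All.map (λ {(i , k)} ik → val'≡val i k (proj₂ ik)) (columnsUpTo-InDiagram (maxPart δ') δ')))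

  ContreLattice-deleted : ContreLatticeFilling γ δ' b F'
  ContreLattice-deleted = ContreLattice-Inserts-min word-Inserts (AllP.map⁺ x-min) cl

-- The hypotheses 1 ≤ n, γ ⊆ δ, b ≥ 1 and the bound on the entries are not needed.
proposition3p3 : (n : ℕ) → 1 ≤ n → (γ δ b : Fin n → ℕ) → (∀ i → γ i ≤ δ i) →
  (∀ i → 1 ≤ b i) → (F : Fin n → ℕ → ℕ) → EntriesIn n γ δ F →
  SSK γ δ b F → ContreLatticeFilling γ δ b F →
  (x : ℕ) (r : Fin n) (c : ℕ) (pre post : List (Cell n)) →
  columnCells γ δ ≡ pre ++ ((r , c) ∷ post) →
  cellVal γ b F r c ≡ x →
  All (λ p → x ≤ valAt γ b F p) (columnCells γ δ) →
  All (λ p → valAt γ b F p ≢ x) pre →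
  SSK γ (deleteShape δ (r , c)) b (deleteFilling F (r , c)) ×
  ContreLatticeFilling γ (deleteShape δ (r , c)) b (deleteFilling F (r , c))
proposition3p3 n _ γ δ b _ _ F _ ssk cl x r c pre post cells≡ val-rc x-min x-first =
  SSK-deleted , ContreLattice-deleted
  where open DeleteFirstMinimum γ δ b F ssk cl x r c pre post cells≡ val-rc x-min x-first
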